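{- Any integral solution to the $k$-median instance $\mathcal I'$ of cost $C$ (i.e., $k$ centers in $D'$ with $\sum_{j\in D'}d'_j c_{i(j)j}=C$, where $i(j)$ is the center serving $j$) yields a solution to the original $\ell$-centrum instance (open the same centers, assign each client $k$ to $i(\sigma(k))$) whose cost, the sum of the $\ell$ largest assignment costs, is at most $C+2\bar B$.
   Context: $\ell$-centrum setting: finite metric space $(\mathcal D,\{c_{ij}\})$, $n=|\mathcal D|>k$, integers $k\ge0$, $\ell\in\{1,\dots,n\}$; $\mathrm{opt}$ is the minimum over choices of $k$ centers of the sum of the $\ell$ largest assignment costs. $f_B(d)=d$ if $d>B/\ell$, else $0$. $\mathrm{OPT}_B$ is the optimum of LP (P$_B$): min $\sum_{i,j}f_B(c_{ij})x_{ij}$ s.t. $\sum_ix_{ij}\ge1$, $0\le x_{ij}\le y_i$, $\sum_iy_i\le k$. Fix $\epsilon>0$ and $\bar B$ with $\mathrm{OPT}_{\bar B}\le\bar B\le(1+\epsilon)\mathrm{opt}$; $(x,y)$ is an optimal solution to (P$_{\bar B}$), $\mathrm{LP}_j=\sum_if_{\bar B}(c_{ij})x_{ij}$. Clustering: set $d'_j=0$ for all $j$; consider clients in increasing order of $\mathrm{LP}_j$; for each client $k$, if some client $j$ has $d'_j>0$ and $c_{jk}\le2\bar B/\ell$, increase $d'_j$ by 1 for one such $j$ and set $\sigma(k)=j$, otherwise set $d'_k=1$. $D'=\{j:d'_j>0\}$ and $\sigma(j)=j$ for $j\in D'$. $\mathcal I'$ is the $k$-median instance on points $D'$ with demands $d'_j$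 and distances $c$.
   Formalization: The distances $c_{ij}$, the parameters ε and $\bar B$, the value $\mathrm{opt}$ and the LP solution $(x,y)$ are rational. -}

module Defs where

open import Data.Nat as ℕ using (ℕ; zero; suc; NonZero)
open import Data.Fin using (Fin; zero; suc; _≟_)
open import Data.Fin.Subset using (Subset; _∈_; ∣_∣)
open import Data.List using (List; []; _∷_; take; reverse; foldr; map; allFin)
open import Data.List.Relation.Binary.Permutation.Propositional using (_↭_)
open import Data.List.Relation.Unary.Linked using (Linked)
open import Data.Rational using (ℚ; 0ℚ; 1ℚ; _+_; _*_; _≤_; _<_; _/_)
open import Data.Rational.Properties using (≤-decTotalOrder; _<?_)
open import Data.List.Sort.InsertionSort.Base ≤-decTotalOrder using (sort)
open import Data.Integer using (+_)
open import Data.Product using (Σ; _×_; ∃; ∃-syntax)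
open import Data.Bool using (if_then_else_)
open import Relation.Nullary using (¬_)
open import Relation.Nullary.Decidable using (⌊_⌋)
open import Relation.Binary.PropositionalEquality using (_≡_)

ℕ→ℚ : ℕ → ℚ
ℕ→ℚ m = + m / 1

ΣFin : ∀ {n} → (Fin n → ℚ) → ℚ
ΣFin {zero}  f = 0ℚ
ΣFin {suc n} f = f zero + ΣFin {n} (λ i → f (suc i))

record IsMetric {n : ℕ} (c : Fin n → Fin n → ℚ) : Set where
  field
    nonneg : ∀ i j → 0ℚ ≤ c i j
    zero-diag : ∀ i → c i i ≡ 0ℚ
    symm : ∀ i j → c i j ≡ c j i
    triangle : ∀ i j k → c i k ≤ c i j + c j k

topSum : ∀ {n} → ℕ → (Fin n → ℚ) → ℚ
topSum ℓ v = foldr _+_ 0ℚ (take ℓ (reverse (sort (map v (allFin _)))))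

_/ℓ_ : ℚ → (ℓ : ℕ) → .{{NonZero ℓ}} → ℚ
B /ℓ ℓ = B * (+ 1 / ℓ)

ValidSol : ∀ {n} → ℕ → Subset n → (Fin n → Fin n) → Set
ValidSol k S a = (∣ S ∣ ℕ.≤ k) × (∀ j → a j ∈ S)

centrumCost : ∀ {n} → (Fin n → Fin n → ℚ) → ℕ → (Fin n → Fin n) → ℚ
centrumCost c ℓ a = topSum ℓ (λ j → c (a j) j)

IsOpt : ∀ {n} → (Fin n → Fin n → ℚ) → ℕ → ℕ → ℚ → Set
IsOpt c k ℓ opt =
  (∃[ S ] ∃[ a ] (ValidSol k S a × centrumCost c ℓ a ≡ opt)) ×
  (∀ S a → ValidSol k S a → opt ≤ centrumCost c ℓ a)

f_ : ℚ → (ℓ : ℕ) → .{{NonZero ℓ}} → ℚ → ℚ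
(f B) ℓ d = if ⌊ (B /ℓ ℓ) <? d ⌋ then d else 0ℚ

LPFeasible : ∀ {n} → ℕ → (Fin n → Fin n → ℚ) → (Fin n → ℚ) → Set
LPFeasible {n} k x y =
  (∀ j → 1ℚ ≤ ΣFin (λ i → x i j)) ×
  (∀ i j → 0ℚ ≤ x i j) × (∀ i j → x i j ≤ y i) ×
  (ΣFin y ≤ ℕ→ℚ k)

LPObj : ∀ {n} → (Fin n → Fin n → ℚ) → ℚ → (ℓ : ℕ) → .{{NonZero ℓ}} →
        (Fin n → Fin n → ℚ) → ℚ
LPObj c B ℓ x = ΣFin (λ i → ΣFin (λ j → (f B) ℓ (c i j) * x i j))

LPOptimal : ∀ {n} → (Fin n → Fin n → ℚ) → ℕ → ℚ → (ℓ : ℕ) → .{{NonZero ℓ}} →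
            (Fin n → Fin n → ℚ) → (Fin n → ℚ) → Set
LPOptimal c k B ℓ x y =
  LPFeasible k x y ×
  (∀ x' y' → LPFeasible k x' y' → LPObj c B ℓ x ≤ LPObj c B ℓ x')

LPj : ∀ {n} → (Fin n → Fin n → ℚ) → ℚ → (ℓ : ℕ) → .{{NonZero ℓ}} →
      (Fin n → Fin n → ℚ) → Fin n → ℚ
LPj c B ℓ x j = ΣFin (λ i → (f B) ℓ (c i j) * x i j)

upd : ∀ {n} {A : Set} → (Fin n → A) → Fin n → A → Fin n → A
upd g a v x = if ⌊ x ≟ a ⌋ then v else g x

-- Run c r d σ ks d' σ' : starting from state (d , σ), processing the
-- clients ks in order (r = 2 B̄ / ℓ is the radius) may end in (d' , σ').
-- The choice "for one such j" is nondeterministic.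
data Run {n : ℕ} (c : Fin n → Fin n → ℚ) (r : ℚ) :
         (Fin n → ℕ) → (Fin n → Fin n) → List (Fin n) →
         (Fin n → ℕ) → (Fin n → Fin n) → Set where
  done : ∀ {d σ} → Run c r d σ [] d σ
  join : ∀ {d σ k ks d' σ'} (j : Fin n) →
         0 ℕ.< d j → c j k ≤ r →
         Run c r (upd d j (suc (d j))) (upd σ k j) ks d' σ' →
         Run c r d σ (k ∷ ks) d' σ'
  open' : ∀ {d σ k ks d' σ'} →
         (∀ j → 0 ℕ.< d j → ¬ (c j k ≤ r)) →
         Run c r (upd d k 1) (upd σ k k) ks d' σ' →
         Run c r d σ (k ∷ ks) d' σ'

-- Initially d' = 0; σ starts as the identity,
-- so that σ(j) = j for j ∈ D' holds at the end.
Clustering : ∀ {n} → (Fin n → Fin n → ℚ) → ℚ → (Fin n → ℚ) →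
             (Fin n → ℕ) → (Fin n → Fin n) → Set
Clustering {n} c r LP d' σ =
  ∃[ order ] ((order ↭ allFin n) ×
              Linked (λ a b → LP a ≤ LP b) order ×
              Run c r (λ _ → 0) (λ j → j) order d' σ)

-- Integral solutions of the k-median instance I' (points D' = {j | d' j > 0},
-- demands d', distances c): a set S ⊆ D' of at most k centres, and a
-- centre i j ∈ S serving each j ∈ D'.

KMedSol : ∀ {n} → ℕ → (Fin n → ℕ) → Subset n → (Fin n → Fin n) → Set
KMedSol k d' S i =
  (∣ S ∣ ℕ.≤ k) × (∀ s → s ∈ S → 0 ℕ.< d' s) × (∀ j → 0 ℕ.< d' j → i j ∈ S)

-- its cost Σ_{j ∈ D'} d'_j c_{i(j) j}  (terms with d'_j = 0 vanish)
KMedCost : ∀ {n} → (Fin n → Fin n → ℚ) → (Fin n → ℕ) → (Fin n → Fin n) → ℚ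
KMedCost c d' i = ΣFin (λ j → ℕ→ℚ (d' j) * c (i j) j)

-- The clustering sends every client m to a centre σ m ∈ D' with c(σ m, m) ≤ r = 2B̄/ℓ, and
-- exactly d'_j clients to each j ∈ D'. Serving m by i(σ m) thus costs at most c(i(σ m), σ m) + r,
-- and the first terms add up to Σ_j d'_j c(i j, j) = C. Truncating each cost at r, the ℓ largest
-- costs exceed their truncations by at most r each, so they sum to at most C + ℓ r = C + 2B̄.
module Submission where

open import Defs
open import Data.Nat as ℕ using (ℕ; NonZero)
open import Data.Fin using (Fin)
open import Data.Fin.Subset using (Subset; _∈_)
open import Data.Rational using (ℚ; 0ℚ; 1ℚ; _+_; _*_; _≤_; _<_)
open import Data.Product using (_×_)
open import Relation.Binary.PropositionalEquality using (_≡_)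

open import Function using (_∘_)
open import Data.Nat using (zero; suc; s≤s; z≤n)
import Data.Nat.Coprimality as Coprime
open import Data.Fin using (zero; suc; _≟_)
open import Data.Fin.Properties using (suc-injective)
import Data.Integer as ℤ
import Data.Integer.Properties as ℤP
open import Data.Rational using (mkℚ; _/_; -_; _-_; _⊔_; nonNegative)
open import Data.Rational.Properties hiding (_≟_)
open import Data.Rational.Solver using (module +-*-Solver)
open import Data.Product using (_,_)
open import Data.Bool using (true; false)
open import Data.List using (List; []; _∷_; _ʳ++_; map; foldr; take; reverse; tabulate; allFin)
open import Data.List.Properties using (map-tabulate; map-cong-local; map-∘)
open import Data.List.Membership.Propositional renaming (_∈_ to _∈ₗ_)
open import Data.List.Membership.Propositional.Properties using (∈-allFin)
open import Data.List.Relation.Unary.All as All using (All)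
open import Data.List.Relation.Unary.Any using (here; there)
import Data.List.Relation.Unary.AllPairs as AllPairs
open import Data.List.Relation.Unary.Unique.Propositional using (Unique)
open import Data.List.Relation.Unary.Unique.Propositional.Properties using (allFin⁺)
open import Data.List.Relation.Binary.Permutation.Propositional
  using (_↭_; ↭-sym; ↭-trans; ↭⇒↭ₛ)
open import Data.List.Relation.Binary.Permutation.Propositional.Properties
  using (∈-resp-↭; ↭-reverse)
  renaming (map⁺ to map-↭)
import Data.List.Relation.Binary.Permutation.Setoid.Properties as Permₛ
open import Data.List.Sort.InsertionSort.Base ≤-decTotalOrder using (sort)
open import Data.List.Sort.InsertionSort.Properties ≤-decTotalOrder using (sort-↭)
open import Relation.Nullary using (¬_; yes; no; contradiction)
open import Relation.Nullary.Decidable using (⌊_⌋)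
open import Relation.Binary.PropositionalEquality
  using (refl; sym; trans; cong; cong₂; subst; _≢_; setoid; module ≡-Reasoning)

open +-*-Solver

ℕ→ℚ-mkℚ : ∀ m → ℕ→ℚ m ≡ mkℚ (ℤ.+ m) 0 (Coprime.sym (Coprime.1-coprimeTo m))
ℕ→ℚ-mkℚ m = ↥p/↧p≡p _

ℕ→ℚ-suc : ∀ m → ℕ→ℚ (suc m) ≡ 1ℚ + ℕ→ℚ m
ℕ→ℚ-suc m rewrite ℕ→ℚ-mkℚ m = cong (λ z → (ℤ.+ 1 ℤ.+ z) / 1) (sym (ℤP.*-identityʳ (ℤ.+ m)))

ℕ→ℚ-nonNeg : ∀ m → 0ℚ ≤ ℕ→ℚ m
ℕ→ℚ-nonNeg m = nonNegative⁻¹ _ {{normalize-nonNeg m 1}}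

ℕ→ℚ-suc-* : ∀ m t → ℕ→ℚ (suc m) * t ≡ t + ℕ→ℚ m * t
ℕ→ℚ-suc-* m t rewrite ℕ→ℚ-suc m = solve 2 (λ a t → (con 1ℚ :+ a) :* t := t :+ a :* t) refl (ℕ→ℚ m) t

ℕ→ℚ-*-/ℓ : ∀ B ℓ .{{_ : NonZero ℓ}} → ℕ→ℚ ℓ * (B /ℓ ℓ) ≡ B
ℕ→ℚ-*-/ℓ B (suc l) = begin
  ℕ→ℚ (suc l) * (B * (ℤ.+ 1 / suc l))  ≡⟨ solve 3 (λ a b c → a :* (b :* c) := (a :* c) :* b)
                                                  refl (ℕ→ℚ (suc l)) B (ℤ.+ 1 / suc l) ⟩
  (ℕ→ℚ (suc l) * (ℤ.+ 1 / suc l)) * B  ≡⟨ cong (_* B) ℓ*1/ℓ≡1 ⟩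
  1ℚ * B                              ≡⟨ *-identityˡ B ⟩
  B                                   ∎
  where
  open ≡-Reasoning
  ℓ*1/ℓ≡1 : ℕ→ℚ (suc l) * (ℤ.+ 1 / suc l) ≡ 1ℚ
  ℓ*1/ℓ≡1 rewrite ℕ→ℚ-mkℚ (suc l) | ↥p/↧p≡p (mkℚ (ℤ.+ 1) l (Coprime.1-coprimeTo (suc l))) =
    *-inverseʳ (mkℚ (ℤ.+ suc l) 0 (Coprime.sym (Coprime.1-coprimeTo (suc l))))

*-nonNeg : ∀ {p q} → 0ℚ ≤ p → 0ℚ ≤ q → 0ℚ ≤ p * q
*-nonNeg {p} {q} 0≤p 0≤q =
  nonNegative⁻¹ _ {{nonNeg*nonNeg⇒nonNeg p {{nonNegative 0≤p}} q {{nonNegative 0≤q}}}}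

/ℓ-nonNeg : ∀ {B} ℓ .{{_ : NonZero ℓ}} → 0ℚ ≤ B → 0ℚ ≤ B /ℓ ℓ
/ℓ-nonNeg ℓ 0≤B = *-nonNeg 0≤B (nonNegative⁻¹ _ {{normalize-nonNeg 1 ℓ}})

sumℚ : List ℚ → ℚ
sumℚ = foldr _+_ 0ℚ

sumℚ-↭ : ∀ {xs ys} → xs ↭ ys → sumℚ xs ≡ sumℚ ys
sumℚ-↭ xs↭ys = Permₛ.foldr-commMonoid (setoid ℚ) +-0-isCommutativeMonoid (↭⇒↭ₛ xs↭ys)

sumℚ-map-allFin : ∀ {n} (G : Fin n → ℚ) → sumℚ (map G (allFin n)) ≡ ΣFin G
sumℚ-map-allFin G = trans (cong sumℚ (map-tabulate (λ i → i) G)) (sumℚ-tabulate G)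
  where
  sumℚ-tabulate : ∀ {n} (G : Fin n → ℚ) → sumℚ (tabulate G) ≡ ΣFin G
  sumℚ-tabulate {zero}  G = refl
  sumℚ-tabulate {suc n} G = cong (G zero +_) (sumℚ-tabulate (G ∘ suc))

ΣFin-mono-≤ : ∀ {n} {G H : Fin n → ℚ} → (∀ i → G i ≤ H i) → ΣFin G ≤ ΣFin H
ΣFin-mono-≤ {zero}  G≤H = ≤-refl
ΣFin-mono-≤ {suc n} G≤H = +-mono-≤ (G≤H zero) (ΣFin-mono-≤ (G≤H ∘ suc))

ΣFin-nonNeg : ∀ {n} {G : Fin n → ℚ} → (∀ i → 0ℚ ≤ G i) → 0ℚ ≤ ΣFin G
ΣFin-nonNeg {zero}  0≤G = ≤-refl
ΣFin-nonNeg {suc n} 0≤G = +-mono-≤ (0≤G zero) (ΣFin-nonNeg (0≤G ∘ suc))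

ΣFin-zero : ∀ {n} {G : Fin n → ℚ} → (∀ i → G i ≡ 0ℚ) → ΣFin G ≡ 0ℚ
ΣFin-zero {zero}  G≡0 = refl
ΣFin-zero {suc n} G≡0 = cong₂ _+_ (G≡0 zero) (ΣFin-zero (G≡0 ∘ suc))

ΣFin-cong : ∀ {n} {G H : Fin n → ℚ} → (∀ i → G i ≡ H i) → ΣFin G ≡ ΣFin H
ΣFin-cong {zero}  G≡H = refl
ΣFin-cong {suc n} G≡H = cong₂ _+_ (G≡H zero) (ΣFin-cong (G≡H ∘ suc))

ΣFin-increase : ∀ {n} {G H : Fin n → ℚ} j a → (∀ i → i ≢ j → H i ≡ G i) → H j ≡ a + G j →
                ΣFin H ≡ a + ΣFin G
ΣFin-increase {suc n} {G} {H} zero a H≡G Hj = begin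
  ΣFin H                         ≡⟨ cong₂ _+_ Hj (ΣFin-cong (λ i → H≡G (suc i) λ ())) ⟩
  (a + G zero) + ΣFin (G ∘ suc) ≡⟨ +-assoc a _ _ ⟩
  a + ΣFin G                     ∎
  where open ≡-Reasoning
ΣFin-increase {suc n} {G} {H} (suc j) a H≡G Hj = begin
  ΣFin H                         ≡⟨ cong₂ _+_ (H≡G zero λ ())
                                      (ΣFin-increase j a (λ i i≢j → H≡G (suc i) (i≢j ∘ suc-injective)) Hj) ⟩
  G zero + (a + ΣFin (G ∘ suc)) ≡⟨ solve 3 (λ g a s → g :+ (a :+ s) := a :+ (g :+ s)) refl (G zero) a _ ⟩
  a + ΣFin G                     ∎
  where open ≡-Reasoning

sum-take-≤ : ∀ {h : ℚ → ℚ} {t} → 0ℚ ≤ t → (∀ z → 0ℚ ≤ h z) → (∀ z → z ≤ h z + t) →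
             ∀ ℓ ys → sumℚ (take ℓ ys) ≤ sumℚ (map h ys) + ℕ→ℚ ℓ * t
sum-take-≤ {h} {t} 0≤t 0≤h z≤hz+t zero ys = begin
  0ℚ                                ≤⟨ sumℚ-nonNeg ys ⟩
  sumℚ (map h ys)                   ≡⟨ sym (+-identityʳ _) ⟩
  sumℚ (map h ys) + 0ℚ              ≡⟨ cong (sumℚ (map h ys) +_) (sym (*-zeroˡ t)) ⟩
  sumℚ (map h ys) + ℕ→ℚ 0 * t       ∎
  where
  open ≤-Reasoning
  sumℚ-nonNeg : ∀ ys → 0ℚ ≤ sumℚ (map h ys)
  sumℚ-nonNeg []       = ≤-refl
  sumℚ-nonNeg (y ∷ ys) = +-mono-≤ (0≤h y) (sumℚ-nonNeg ys)
sum-take-≤ {t = t} 0≤t 0≤h z≤hz+t (suc ℓ) [] =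
  ≤-trans (*-nonNeg (ℕ→ℚ-nonNeg (suc ℓ)) 0≤t) (≤-reflexive (sym (+-identityˡ (ℕ→ℚ (suc ℓ) * t))))
sum-take-≤ {h} {t} 0≤t 0≤h z≤hz+t (suc ℓ) (y ∷ ys) = begin
  y + sumℚ (take ℓ ys)                          ≤⟨ +-mono-≤ (z≤hz+t y) (sum-take-≤ 0≤t 0≤h z≤hz+t ℓ ys) ⟩
  (h y + t) + (sumℚ (map h ys) + ℕ→ℚ ℓ * t)    ≡⟨ solve 4 (λ a t b c → (a :+ t) :+ (b :+ c) := (a :+ b) :+ (t :+ c))
                                                        refl (h y) t (sumℚ (map h ys)) (ℕ→ℚ ℓ * t) ⟩
  (h y + sumℚ (map h ys)) + (t + ℕ→ℚ ℓ * t)    ≡⟨ cong (h y + sumℚ (map h ys) +_) (sym (ℕ→ℚ-suc-* ℓ t)) ⟩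
  (h y + sumℚ (map h ys)) + ℕ→ℚ (suc ℓ) * t    ∎
  where open ≤-Reasoning

-- Truncating each value at t gives the bound ∑ⱼ max(vⱼ - t, 0) + ℓ t.
topSum-≤ : ∀ {n} ℓ {v u : Fin n → ℚ} {t} → 0ℚ ≤ t → (∀ j → 0ℚ ≤ u j) → (∀ j → v j ≤ u j + t) →
           topSum ℓ v ≤ ΣFin u + ℕ→ℚ ℓ * t
topSum-≤ {n} ℓ {v} {u} {t} 0≤t 0≤u v≤u+t = begin
  topSum ℓ v                                ≤⟨ sum-take-≤ 0≤t 0≤h z≤hz+t ℓ (reverse (sort vs)) ⟩
  sumℚ (map h (reverse (sort vs))) + ℓt     ≡⟨ cong (_+ ℓt) (sumℚ-↭ (map-↭ h (↭-trans (↭-reverse _) (sort-↭ vs)))) ⟩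
  sumℚ (map h vs) + ℓt                      ≡⟨ cong (λ zs → sumℚ zs + ℓt) (sym (map-∘ (allFin n))) ⟩
  sumℚ (map (h ∘ v) (allFin n)) + ℓt        ≡⟨ cong (_+ ℓt) (sumℚ-map-allFin (h ∘ v)) ⟩
  ΣFin (h ∘ v) + ℓt                         ≤⟨ +-monoˡ-≤ ℓt (ΣFin-mono-≤ hv≤u) ⟩
  ΣFin u + ℓt                               ∎
  where
  open ≤-Reasoning
  vs = map v (allFin n)
  ℓt = ℕ→ℚ ℓ * t
  h : ℚ → ℚ
  h z = (z - t) ⊔ 0ℚ
  0≤h : ∀ z → 0ℚ ≤ h z
  0≤h z = p≤q⊔p (z - t) 0ℚ
  z≤hz+t : ∀ z → z ≤ h z + t
  z≤hz+t z = subst (_≤ h z + t) (solve 2 (λ z t → (z :- t) :+ t := z) refl z t)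
                   (+-monoˡ-≤ t (p≤p⊔q (z - t) 0ℚ))
  hv≤u : ∀ j → h (v j) ≤ u j
  hv≤u j = ⊔-lub (subst (v j - t ≤_) (solve 2 (λ u t → (u :+ t) :- t := u) refl (u j) t)
                         (+-monoˡ-≤ (- t) (v≤u+t j)))
                 (0≤u j)

upd-≡ : ∀ {n} {A : Set} (g : Fin n → A) a v → upd g a v a ≡ v
upd-≡ g a v with a ≟ a
... | yes _   = refl
... | no a≢a = contradiction refl a≢a

upd-≢ : ∀ {n} {A : Set} (g : Fin n → A) a v {x} → x ≢ a → upd g a v x ≡ g x
upd-≢ g a v {x} x≢a with x ≟ a
... | yes x≡a = contradiction x≡a x≢a
... | no _    = refl

Unique-ʳ++⁻ʳ : ∀ {A : Set} (xs : List A) {ys} → Unique (xs ʳ++ ys) → Unique ys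
Unique-ʳ++⁻ʳ []       u = u
Unique-ʳ++⁻ʳ (x ∷ xs) u = AllPairs.tail (Unique-ʳ++⁻ʳ xs u)

module _ {n} (c : Fin n → Fin n → ℚ) (r : ℚ) where

  record Invariant (d : Fin n → ℕ) (σ : Fin n → Fin n) (P : List (Fin n)) : Set where
    field
      assigned-open : ∀ {m} → m ∈ₗ P → 0 ℕ.< d (σ m)
      assigned-near : ∀ {m} → m ∈ₗ P → c (σ m) m ≤ r
      demand-sum    : ∀ g → sumℚ (map (g ∘ σ) P) ≡ ΣFin (λ j → ℕ→ℚ (d j) * g j)

  record ClusteringOutcome (d : Fin n → ℕ) (σ : Fin n → Fin n) : Set where
    field
      centre-open : ∀ m → 0 ℕ.< d (σ m)
      centre-near : ∀ m → c (σ m) m ≤ r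
      demand-sum  : ∀ g → ΣFin (g ∘ σ) ≡ ΣFin (λ j → ℕ→ℚ (d j) * g j)

module _ {n} {c : Fin n → Fin n → ℚ} {r : ℚ} where

  Invariant-[] : Invariant c r (λ _ → 0) (λ j → j) []
  Invariant-[] = record
    { assigned-open = λ ()
    ; assigned-near = λ ()
    ; demand-sum    = λ g → sym (ΣFin-zero (λ j → *-zeroˡ (g j)))
    }

  Invariant-assign : ∀ {d σ P} k j {v} → All (k ≢_) P → v ≡ suc (d j) → c j k ≤ r →
                     Invariant c r d σ P → Invariant c r (upd d j v) (upd σ k j) (k ∷ P)
  Invariant-assign {d} {σ} {P} k j {v} k∉P v≡1+dj cjk≤r inv = record
    { assigned-open = assigned-open′
    ; assigned-near = assigned-near′
    ; demand-sum    = demand-sum′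
    }
    where
    open Invariant inv
    σ′≡σ : ∀ {m} → k ≢ m → upd σ k j m ≡ σ m
    σ′≡σ k≢m = upd-≢ σ k j (k≢m ∘ sym)
    0<v : 0 ℕ.< v
    0<v = subst (0 ℕ.<_) (sym v≡1+dj) (s≤s z≤n)
    assigned-open′ : ∀ {m} → m ∈ₗ k ∷ P → 0 ℕ.< upd d j v (upd σ k j m)
    assigned-open′ (here refl) rewrite upd-≡ σ k j | upd-≡ d j v = 0<v
    assigned-open′ {m} (there m∈P) rewrite σ′≡σ (All.lookup k∉P m∈P) with σ m ≟ j
    ... | yes _ = 0<v
    ... | no _  = assigned-open m∈P
    assigned-near′ : ∀ {m} → m ∈ₗ k ∷ P → c (upd σ k j m) m ≤ r
    assigned-near′ (here refl) rewrite upd-≡ σ k j = cjk≤r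
    assigned-near′ (there m∈P) rewrite σ′≡σ (All.lookup k∉P m∈P) = assigned-near m∈P
    demand-sum′ : ∀ g → sumℚ (map (g ∘ upd σ k j) (k ∷ P)) ≡ ΣFin (λ i → ℕ→ℚ (upd d j v i) * g i)
    demand-sum′ g = begin
      g (upd σ k j k) + sumℚ (map (g ∘ upd σ k j) P)  ≡⟨ cong₂ _+_ (cong g (upd-≡ σ k j))
                                                          (cong sumℚ (map-cong-local (All.map (cong g ∘ σ′≡σ) k∉P))) ⟩
      g j + sumℚ (map (g ∘ σ) P)                      ≡⟨ cong (g j +_) (demand-sum g) ⟩
      g j + ΣFin (λ i → ℕ→ℚ (d i) * g i)              ≡⟨ sym (ΣFin-increase j (g j) d′≡d d′j) ⟩
      ΣFin (λ i → ℕ→ℚ (upd d j v i) * g i)            ∎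
      where
      open ≡-Reasoning
      d′≡d : ∀ i → i ≢ j → ℕ→ℚ (upd d j v i) * g i ≡ ℕ→ℚ (d i) * g i
      d′≡d i i≢j = cong (λ z → ℕ→ℚ z * g i) (upd-≢ d j v i≢j)
      d′j : ℕ→ℚ (upd d j v j) * g j ≡ g j + ℕ→ℚ (d j) * g j
      d′j rewrite upd-≡ d j v | v≡1+dj = ℕ→ℚ-suc-* (d j) (g j)

  -- k lies at distance 0 ≤ r from itself.
  opened-was-closed : 0ℚ ≤ r → (∀ i → c i i ≡ 0ℚ) → ∀ (d : Fin n → ℕ) k →
                      (∀ j → 0 ℕ.< d j → ¬ (c j k ≤ r)) → d k ≡ 0
  opened-was-closed 0≤r c-diag d k far with d k in dk≡
  ... | zero  = refl
  ... | suc _ = contradiction (subst (_≤ r) (sym (c-diag k)) 0≤r)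
                              (far k (subst (0 ℕ.<_) (sym dk≡) (s≤s z≤n)))

  -- (k ∷ ks) ʳ++ P reduces to ks ʳ++ (k ∷ P), so the processed list needs no bookkeeping.
  run-invariant : 0ℚ ≤ r → (∀ i → c i i ≡ 0ℚ) →
                  ∀ {d σ ks d′ σ′ P} → Run c r d σ ks d′ σ′ → Unique (ks ʳ++ P) →
                  Invariant c r d σ P → Invariant c r d′ σ′ (ks ʳ++ P)
  run-invariant 0≤r c-diag done u inv = inv
  run-invariant 0≤r c-diag {ks = k ∷ ks} (join j _ cjk≤r run) u inv =
    run-invariant 0≤r c-diag run u (Invariant-assign k j k∉P refl cjk≤r inv)
    where k∉P = AllPairs.head (Unique-ʳ++⁻ʳ ks u)
  run-invariant 0≤r c-diag {d} {ks = k ∷ ks} (open' far run) u inv =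
    run-invariant 0≤r c-diag run u
      (Invariant-assign k k k∉P (cong suc (sym (opened-was-closed 0≤r c-diag d k far)))
                        (subst (_≤ r) (sym (c-diag k)) 0≤r) inv)
    where k∉P = AllPairs.head (Unique-ʳ++⁻ʳ ks u)

  clustering-outcome : 0ℚ ≤ r → (∀ i → c i i ≡ 0ℚ) → ∀ {LP d σ} →
                       Clustering c r LP d σ → ClusteringOutcome c r d σ
  clustering-outcome 0≤r c-diag {d = d} {σ} (order , order↭ , _ , run) = record
    { centre-open = λ m → assigned-open (every m)
    ; centre-near = λ m → assigned-near (every m)
    ; demand-sum  = λ g → begin
        ΣFin (g ∘ σ)                          ≡⟨ sym (sumℚ-map-allFin (g ∘ σ)) ⟩
        sumℚ (map (g ∘ σ) (allFin n))          ≡⟨ sumℚ-↭ (map-↭ (g ∘ σ) (↭-sym reversed↭)) ⟩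
        sumℚ (map (g ∘ σ) (reverse order))     ≡⟨ demand-sum g ⟩
        ΣFin (λ j → ℕ→ℚ (d j) * g j)           ∎
    }
    where
    open ≡-Reasoning
    reversed↭ : reverse order ↭ allFin n
    reversed↭ = ↭-trans (↭-reverse order) order↭
    every : ∀ m → m ∈ₗ reverse order
    every m = ∈-resp-↭ (↭-sym reversed↭) (∈-allFin m)
    unique : Unique (reverse order)
    unique = Permₛ.Unique-resp-↭ (setoid (Fin n)) (↭⇒↭ₛ (↭-sym reversed↭)) (allFin⁺ n)
    open Invariant (run-invariant 0≤r c-diag run unique Invariant-[])

f-nonNeg : ∀ B ℓ .{{_ : NonZero ℓ}} {d} → 0ℚ ≤ d → 0ℚ ≤ (f B) ℓ d
f-nonNeg B ℓ {d} 0≤d with ⌊ (B /ℓ ℓ) <? d ⌋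
... | true  = 0≤d
... | false = ≤-refl

LPObj-nonNeg : ∀ {n} {c x : Fin n → Fin n → ℚ} B ℓ .{{_ : NonZero ℓ}} →
               (∀ i j → 0ℚ ≤ c i j) → (∀ i j → 0ℚ ≤ x i j) → 0ℚ ≤ LPObj c B ℓ x
LPObj-nonNeg B ℓ 0≤c 0≤x =
  ΣFin-nonNeg λ i → ΣFin-nonNeg λ j → *-nonNeg (f-nonNeg B ℓ (0≤c i j)) (0≤x i j)

lemma5 : (n k ℓ : ℕ) .{{_ : NonZero ℓ}} → k ℕ.< n → ℓ ℕ.≤ n →
    (c : Fin n → Fin n → ℚ) → IsMetric c →
    (ε : ℚ) → 0ℚ < ε →
    (opt : ℚ) → IsOpt c k ℓ opt →
    (B̄ : ℚ) (x : Fin n → Fin n → ℚ) (y : Fin n → ℚ) →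
    LPOptimal c k B̄ ℓ x y →
    LPObj c B̄ ℓ x ≤ B̄ → B̄ ≤ (1ℚ + ε) * opt →
    (d' : Fin n → ℕ) (σ : Fin n → Fin n) →
    Clustering c ((ℕ→ℚ 2 * B̄) /ℓ ℓ) (LPj c B̄ ℓ x) d' σ →
    (S : Subset n) (i : Fin n → Fin n) → KMedSol k d' S i →
    (C : ℚ) → KMedCost c d' i ≡ C →
    ValidSol k S (λ j → i (σ j)) ×
    centrumCost c ℓ (λ j → i (σ j)) ≤ C + ℕ→ℚ 2 * B̄
lemma5 n k ℓ _ _ c metric _ _ _ _ B̄ x _ ((_ , 0≤x , _) , _) obj≤B̄ _ d' σ clustering
       S i (∣S∣≤k , _ , centres-in-S) C cost≡C =
  (∣S∣≤k , λ j → centres-in-S (σ j) (centre-open j)) , cost-bound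
  where
  open IsMetric metric
  r = (ℕ→ℚ 2 * B̄) /ℓ ℓ
  0≤r : 0ℚ ≤ r
  0≤r = /ℓ-nonNeg ℓ (*-nonNeg (ℕ→ℚ-nonNeg 2) (≤-trans (LPObj-nonNeg B̄ ℓ nonneg 0≤x) obj≤B̄))
  open ClusteringOutcome (clustering-outcome 0≤r zero-diag clustering)
  cost-bound : centrumCost c ℓ (λ j → i (σ j)) ≤ C + ℕ→ℚ 2 * B̄
  cost-bound = begin
    topSum ℓ (λ j → c (i (σ j)) j)              ≤⟨ topSum-≤ ℓ 0≤r (λ j → nonneg _ _) detour ⟩
    ΣFin (λ j → c (i (σ j)) (σ j)) + ℕ→ℚ ℓ * r  ≡⟨ cong₂ _+_ (trans (demand-sum (λ j → c (i j) j)) cost≡C)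
                                                            (ℕ→ℚ-*-/ℓ (ℕ→ℚ 2 * B̄) ℓ) ⟩
    C + ℕ→ℚ 2 * B̄                               ∎
    where
    open ≤-Reasoning
    detour : ∀ j → c (i (σ j)) j ≤ c (i (σ j)) (σ j) + r
    detour j = ≤-trans (triangle (i (σ j)) (σ j) j) (+-monoʳ-≤ (c (i (σ j)) (σ j)) (centre-near j))
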